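{- For every graph $G$ with at least one edge, $\gamma_{\{2\}}(G)\le 2\gamma_{w2}(G)-1$.
   Context: $G=(V,E)$ finite simple graph, $N(v)$, $N[v]$ open and closed neighborhoods. $\gamma_{\{2\}}(G)$ is the minimum of $\sum_v f(v)$ over $f:V\to\{0,1,2\}$ with $\sum_{w\in N[v]}f(w)\ge 2$ for all $v$. $\gamma_{w2}(G)$ is the minimum of $\sum_v f(v)$ over $f:V\to\{0,1,2\}$ such that $\sum_{w\in N(v)}f(w)\ge 2$ for every $v$ with $f(v)=0$. -}

module Defs where

open import Data.Nat using (ℕ; zero; suc; _+_; _≤_)
open import Data.Fin using (Fin; zero; suc; toℕ)
open import Data.Bool using (Bool; true; false; if_then_else_)
open import Data.Product using (Σ; ∃; _×_; _,_)
open import Relation.Binary.PropositionalEquality using (_≡_)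
open import Relation.Nullary using (¬_)

record Graph (n : ℕ) : Set where
  field
    adj   : Fin n → Fin n → Bool
    sym   : ∀ u v → adj u v ≡ adj v u
    irrefl : ∀ v → adj v v ≡ false
open Graph public

sumFin : ∀ {n} → (Fin n → ℕ) → ℕ
sumFin {zero}  f = 0
sumFin {suc n} f = f zero + sumFin (λ i → f (suc i))

HasEdge : ∀ {n} → Graph n → Set
HasEdge G = ∃ λ u → ∃ λ v → adj G u v ≡ true

Labelling : ℕ → Set
Labelling n = Fin n → Fin 3

weight : ∀ {n} → Labelling n → ℕ
weight f = sumFin (λ v → toℕ (f v))

nbSum : ∀ {n} → Graph n → Labelling n → Fin n → ℕ
nbSum G f v = sumFin (λ w → if adj G v w then toℕ (f w) else 0)

closedNbSum : ∀ {n} → Graph n → Labelling n → Fin n → ℕ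
closedNbSum G f v = toℕ (f v) + nbSum G f v

IsTwoDom : ∀ {n} → Graph n → Labelling n → Set
IsTwoDom G f = ∀ v → 2 ≤ closedNbSum G f v

IsWeakTwoDom : ∀ {n} → Graph n → Labelling n → Set
IsWeakTwoDom G f = ∀ v → f v ≡ zero → 2 ≤ nbSum G f v

IsMinWeight : ∀ {n} → (Labelling n → Set) → ℕ → Set
IsMinWeight {n} P k =
  (Σ (Labelling n) λ f → P f × weight f ≡ k)
  × (∀ (f : Labelling n) → P f → k ≤ weight f)

IsGamma2 : ∀ {n} → Graph n → ℕ → Set
IsGamma2 G k = IsMinWeight (IsTwoDom G) k

IsGammaW2 : ∀ {n} → Graph n → ℕ → Set
IsGammaW2 G k = IsMinWeight (IsWeakTwoDom G) k

module Submission where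

-- Let f be a weak {2}-dominating function.  We pick a centre x such that
-- f(x) = 1 forces positive weight in N(x) (possible because G has an edge),
-- and lift f to the labelling g given by
--   g(x) = max(1, f(x)),   g(v) = f(v) on N(x),
--   g(v) = 2·[f(v) > 0]    on all remaining vertices.
-- Then g ≥ f, and g is {2}-dominating: a vertex with f(v) = 0 already sees
-- weight 2 in N(v); x sees itself and its positive neighbours; a neighbour
-- of x also sees x; every other positive vertex now carries 2.
-- For the weight, compare g with 2f vertex by vertex: off N[x] we have
-- g ≤ 2f, on N(x) we save exactly f(v), and at x we lose at most that total
-- saving f(N(x)) minus one.  Summing gives w(g) + 1 ≤ 2 w(f).

open import Defs hiding (sym)
open import Data.Nat using (ℕ; zero; suc; _+_; _*_; _≤_; z≤n; s≤s)
open import Data.Nat.Properties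
  using (≤-refl; ≤-trans; +-mono-≤; +-monoˡ-≤; +-cancelˡ-≤; m≤m+n; m≤n+m;
         +-comm; +-suc; +-identityʳ; +-commutativeSemigroup; module ≤-Reasoning)
open import Algebra.Properties.CommutativeSemigroup +-commutativeSemigroup
  using (interchange)
open import Data.Fin using (Fin; toℕ) renaming (suc to fsuc)
open import Data.Fin.Patterns using (0F; 1F; 2F)
open import Data.Fin.Properties using (_≟_; 0≢1+n)
open import Data.Bool using (true; false; if_then_else_)
open import Data.Product using (∃; _,_)
open import Data.Empty using (⊥-elim)
open import Relation.Nullary using (yes; no; does)
open import Relation.Binary.PropositionalEquality
  using (_≡_; _≢_; refl; sym; trans; cong; cong₂; subst; subst₂; module ≡-Reasoning)

sumFin-mono : ∀ {n} {f g : Fin n → ℕ} → (∀ i → f i ≤ g i) → sumFin f ≤ sumFin g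
sumFin-mono {zero}  f≤g = z≤n
sumFin-mono {suc n} f≤g = +-mono-≤ (f≤g 0F) (sumFin-mono (λ i → f≤g (fsuc i)))

sumFin-+ : ∀ {n} (f g : Fin n → ℕ) →
  sumFin (λ i → f i + g i) ≡ sumFin f + sumFin g
sumFin-+ {zero}  f g = refl
sumFin-+ {suc n} f g = begin
  (f 0F + g 0F) + sumFin (λ i → f (fsuc i) + g (fsuc i))
    ≡⟨ cong (f 0F + g 0F +_) (sumFin-+ (λ i → f (fsuc i)) (λ i → g (fsuc i))) ⟩
  (f 0F + g 0F) + (sumFin (λ i → f (fsuc i)) + sumFin (λ i → g (fsuc i)))
    ≡⟨ interchange (f 0F) (g 0F) _ _ ⟩
  (f 0F + sumFin (λ i → f (fsuc i))) + (g 0F + sumFin (λ i → g (fsuc i))) ∎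
  where open ≡-Reasoning

sumFin-mono₂ : ∀ {n} (a b c d : Fin n → ℕ) → (∀ i → a i + b i ≤ c i + d i) →
  sumFin a + sumFin b ≤ sumFin c + sumFin d
sumFin-mono₂ a b c d pointwise =
  subst₂ _≤_ (sumFin-+ a b) (sumFin-+ c d) (sumFin-mono pointwise)

term≤sumFin : ∀ {n} (f : Fin n → ℕ) (i : Fin n) → f i ≤ sumFin f
term≤sumFin f 0F       = m≤m+n (f 0F) _
term≤sumFin f (fsuc i) = ≤-trans (term≤sumFin (λ j → f (fsuc j)) i) (m≤n+m _ (f 0F))

pointMass : ∀ {n} → Fin n → ℕ → Fin n → ℕ
pointMass x K v = if does (v ≟ x) then K else 0

sumFin-zero : ∀ n → sumFin {n} (λ _ → 0) ≡ 0
sumFin-zero zero    = refl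
sumFin-zero (suc n) = sumFin-zero n

sumFin-pointMass : ∀ {n} (x : Fin n) (K : ℕ) → sumFin (pointMass x K) ≡ K
sumFin-pointMass {suc n} 0F       K = trans (cong (K +_) (sumFin-zero n)) (+-identityʳ K)
sumFin-pointMass {suc n} (fsuc x) K = sumFin-pointMass x K

nbSum-mono : ∀ {n} (G : Graph n) {f h : Labelling n} →
  (∀ w → toℕ (f w) ≤ toℕ (h w)) → ∀ v → nbSum G f v ≤ nbSum G h v
nbSum-mono G {f} {h} f≤h v = sumFin-mono term
  where
  term : ∀ w → (if adj G v w then toℕ (f w) else 0) ≤ (if adj G v w then toℕ (h w) else 0)
  term w with adj G v w
  ... | true  = f≤h w
  ... | false = ≤-refl

neighbour≤nbSum : ∀ {n} (G : Graph n) (f : Labelling n) {v w : Fin n} →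
  adj G v w ≡ true → toℕ (f w) ≤ nbSum G f v
neighbour≤nbSum G f {v} {w} vw =
  subst (_≤ nbSum G f v) (cong (λ b → if b then toℕ (f w) else 0) vw)
        (term≤sumFin (λ u → if adj G v u then toℕ (f u) else 0) w)

positive : (t : Fin 3) → t ≢ 0F → 1 ≤ toℕ t
positive 0F       t≢0 = ⊥-elim (t≢0 refl)
positive (fsuc _) _   = s≤s z≤n

raise : Fin 3 → Fin 3
raise 0F = 1F
raise t  = t

double : Fin 3 → Fin 3
double 0F = 0F
double _  = 2F

raise-≥ : ∀ (t : Fin 3) → toℕ t ≤ toℕ (raise t)
raise-≥ 0F = z≤n
raise-≥ 1F = ≤-refl
raise-≥ 2F = ≤-refl

raise-positive : ∀ (t : Fin 3) → 1 ≤ toℕ (raise t)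
raise-positive 0F = s≤s z≤n
raise-positive 1F = s≤s z≤n
raise-positive 2F = s≤s z≤n

double-≥ : ∀ (t : Fin 3) → toℕ t ≤ toℕ (double t)
double-≥ 0F = z≤n
double-≥ 1F = s≤s z≤n
double-≥ 2F = ≤-refl

-- Weight cost at the centre: 1 + raise t ≤ 2t, except for t = 0, where the
-- neighbourhood weight M ≥ 2 supplied by the weak condition pays.
raise-cost : ∀ (t : Fin 3) {M} → (t ≡ 0F → 2 ≤ M) → 1 + toℕ (raise t) ≤ M + (toℕ t + toℕ t)
raise-cost 0F {M} weak = subst (2 ≤_) (sym (+-identityʳ M)) (weak refl)
raise-cost 1F {M} _    = m≤n+m 2 M
raise-cost 2F {M} _    = ≤-trans (s≤s (s≤s (s≤s z≤n))) (m≤n+m 4 M)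

double-cost : ∀ (t : Fin 3) → toℕ (double t) ≤ toℕ t + toℕ t
double-cost 0F = z≤n
double-cost 1F = ≤-refl
double-cost 2F = s≤s (s≤s z≤n)

raise-dominates : ∀ (t : Fin 3) {M} → (t ≡ 0F → 2 ≤ M) → (t ≡ 1F → 1 ≤ M) →
  2 ≤ toℕ (raise t) + M
raise-dominates 0F weak _   = ≤-trans (weak refl) (m≤n+m _ 1)
raise-dominates 1F _    one = s≤s (one refl)
raise-dominates 2F _    _   = m≤m+n 2 _

seen-dominates : ∀ (t : Fin 3) {M} → (t ≡ 0F → 2 ≤ M) → 1 ≤ M → 2 ≤ toℕ t + M
seen-dominates 0F weak _    = weak refl
seen-dominates 1F _    seen = s≤s seen
seen-dominates 2F _    _    = m≤m+n 2 _

double-dominates : ∀ (t : Fin 3) {M} → (t ≡ 0F → 2 ≤ M) → 2 ≤ toℕ (double t) + M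
double-dominates 0F weak = weak refl
double-dominates 1F _    = m≤m+n 2 _
double-dominates 2F _    = m≤m+n 2 _

-- Any graph with an edge has a centre for every labelling:
-- take an endpoint u of an edge uv, unless f(u) = 1 and f(v) = 0, in which
-- case v works.
IsCentre : ∀ {n} → Graph n → Labelling n → Fin n → Set
IsCentre G f x = f x ≡ 1F → 1 ≤ nbSum G f x

centre : ∀ {n} (G : Graph n) → HasEdge G → (f : Labelling n) → ∃ (IsCentre G f)
centre G (u , v , uv) f with f u ≟ 1F | f v ≟ 0F
... | no  fu≢1 | _       = u , λ fu≡1 → ⊥-elim (fu≢1 fu≡1)
... | yes _    | yes fv≡0 = v , λ fv≡1 → ⊥-elim (0≢1+n (trans (sym fv≡0) fv≡1))
... | yes _    | no  fv≢0 = u , λ _ → ≤-trans (positive (f v) fv≢0) (neighbour≤nbSum G f uv)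

module Lift {n : ℕ} (G : Graph n) (f : Labelling n) (x : Fin n) where

  lift : Labelling n
  lift v with v ≟ x | adj G x v
  ... | yes _ | _     = raise (f x)
  ... | no  _ | true  = f v
  ... | no  _ | false = double (f v)

  lift-≥ : ∀ v → toℕ (f v) ≤ toℕ (lift v)
  lift-≥ v with v ≟ x | adj G x v
  ... | yes refl | _     = raise-≥ (f v)
  ... | no  _    | true  = ≤-refl
  ... | no  _    | false = double-≥ (f v)

  lift-centre-positive : 1 ≤ toℕ (lift x)
  lift-centre-positive with x ≟ x
  ... | yes _   = raise-positive (f x)
  ... | no  x≢x = ⊥-elim (x≢x refl)

  lift-weak : IsWeakTwoDom G f → ∀ v → f v ≡ 0F → 2 ≤ nbSum G lift v
  lift-weak weak v fv≡0 = ≤-trans (weak v fv≡0) (nbSum-mono G lift-≥ v)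

  lift-isTwoDom : IsWeakTwoDom G f → IsCentre G f x → IsTwoDom G lift
  lift-isTwoDom weak centred v with v ≟ x | adj G x v in xv
  ... | yes refl | _     = raise-dominates (f v) (lift-weak weak v)
                             (λ fv≡1 → ≤-trans (centred fv≡1) (nbSum-mono G lift-≥ v))
  ... | no  _    | true  = seen-dominates (f v) (lift-weak weak v)
                             (≤-trans lift-centre-positive (neighbour≤nbSum G lift (trans (Graph.sym G v x) xv)))
  ... | no  _    | false = double-dominates (f v) (lift-weak weak v)

  -- What the lift saves at v compared with 2f; the savings total nbSum G f x.
  saving : Fin n → ℕ
  saving v = if adj G x v then toℕ (f v) else 0

  -- Vertex-by-vertex comparison of the lift with 2f: the point mass at x
  -- records that the savings of the neighbours of x pay for the centre.
  lift-cost : (f x ≡ 0F → 2 ≤ nbSum G f x) → ∀ v →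
    pointMass x 1 v + (saving v + toℕ (lift v))
      ≤ pointMass x (nbSum G f x) v + (toℕ (f v) + toℕ (f v))
  lift-cost weakˣ v with v ≟ x | adj G x v in xv
  ... | yes refl | false = raise-cost (f v) weakˣ
  ... | yes refl | true  with () ← trans (sym xv) (irrefl G v)
  ... | no  _    | true  = ≤-refl
  ... | no  _    | false = double-cost (f v)

  lift-weight : (f x ≡ 0F → 2 ≤ nbSum G f x) → weight lift + 1 ≤ 2 * weight f
  lift-weight weakˣ = +-cancelˡ-≤ N _ _ (begin
    N + (weight lift + 1)
      ≡⟨ cong (N +_) (+-comm (weight lift) 1) ⟩
    N + suc (weight lift)
      ≡⟨ +-suc N (weight lift) ⟩
    1 + (N + weight lift)
      ≡⟨ sym (cong₂ _+_ (sumFin-pointMass x 1) (sumFin-+ saving (λ v → toℕ (lift v)))) ⟩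
    sumFin (pointMass x 1) + sumFin (λ v → saving v + toℕ (lift v))
      ≤⟨ sumFin-mono₂ _ _ _ _ (lift-cost weakˣ) ⟩
    sumFin (pointMass x N) + sumFin (λ v → toℕ (f v) + toℕ (f v))
      ≡⟨ cong₂ _+_ (sumFin-pointMass x N) (sumFin-+ (λ v → toℕ (f v)) (λ v → toℕ (f v))) ⟩
    N + (weight f + weight f)
      ≡⟨ cong (λ w → N + (weight f + w)) (sym (+-identityʳ (weight f))) ⟩
    N + 2 * weight f ∎)
    where
    open ≤-Reasoning
    N : ℕ
    N = nbSum G f x

mainTheorem9 : ∀ (n : ℕ) (G : Graph n) → HasEdge G →
    ∀ (a b : ℕ) → IsGamma2 G a → IsGammaW2 G b → a + 1 ≤ 2 * b
mainTheorem9 n G edge a b (_ , γ₂-minimal) ((f , weak , wf≡b) , _)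
  with centre G edge f
... | x , centred = begin
  a + 1                  ≤⟨ +-monoˡ-≤ 1 (γ₂-minimal lift (lift-isTwoDom weak centred)) ⟩
  weight lift + 1        ≤⟨ lift-weight (weak x) ⟩
  2 * weight f           ≡⟨ cong (2 *_) wf≡b ⟩
  2 * b                  ∎
  where
  open Lift G f x
  open ≤-Reasoning
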